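{- Let $n=tr$ with $t,r>1$, let $f\in\mathcal{L}_{t,q}$ be a scattered polynomial, let $a,b\in\mathbb{F}_{q^t}$ with $b\neq 0$, and let $\omega\in\mathbb{F}_{q^n}$ be such that $\{1,\omega,\ldots,\omega^{r-1}\}$ is an $\mathbb{F}_{q^t}$-basis of $\mathbb{F}_{q^n}$. Let $U_{a,b}=\{(f(x_0)-ax_0,\ bx_0+\sum_{i=1}^{r-1}x_i\omega^i) : x_0,\ldots,x_{r-1}\in\mathbb{F}_{q^t}\}$. Then $L_{U_{a,b}}$ is $\mathrm{PGL}(2,q^n)$-equivalent to $L_{U_p}$, where $U_p=\{(x,p(x)) : x\in\mathbb{F}_{q^n}\}$ and $p(x)=\mathrm{Tr}_{q^n/q^t}(f(x)-ax)$.
   Context: $q$ is a prime power. $\mathcal{L}_{t,q}$ is the set of $q$-polynomials $\sum_i c_ix^{q^i}$ with coefficients in $\mathbb{F}_{q^t}$ (viewed also as maps on $\mathbb{F}_{q^n}$). $f\in\mathcal{L}_{t,q}$ is scattered if $\dim_{\mathbb{F}_q}\ker(f(x)-mx)\le 1$ on $\mathbb{F}_{q^t}$ for all $m\in\mathbb{F}_{q^t}$. $\mathrm{Tr}_{q^n/q^t}(x)=\sum_{j=0}^{r-1}x^{q^{tj}}$. For an $\mathbb{F}_q$-subspace $U$ of $\mathbb{F}_{q^n}^2$, $L_U=\{\langle u\rangle_{\mathbb{F}_{q^n}}: u\in U\setminus\{0\}\}\subseteq\mathrm{PG}(1,q^n)$; linear sets are $\mathrm{PGL}(2,q^n)$-equivalent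 if a projectivity maps one onto the other. -}

module Defs where

open import Level using (0ℓ)
open import Algebra.Bundles using (CommutativeRing)
open import Data.Nat as ℕ using (ℕ; zero; suc; _∸_)
open import Data.Nat.Primality using (Prime)
open import Data.Fin using (Fin; toℕ)
open import Data.List using (List; []; _∷_)
open import Data.List.Relation.Unary.All using (All)
open import Data.Product using (Σ; ∃; _×_; _,_)
open import Data.Sum using (_⊎_)
open import Relation.Nullary using (¬_; Dec)
open import Relation.Binary.PropositionalEquality using (_≡_)

IsPrimePower : ℕ → Set
IsPrimePower q = Σ ℕ λ p → Σ ℕ λ k → Prime p × (k ℕ.≥ 1) × (q ≡ p ℕ.^ k)

record Field : Set₁ where
  field
    cring : CommutativeRing 0ℓ 0ℓ
  open CommutativeRing cring public
  field
    0≉1   : ¬ (0# ≈ 1#)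
    _≟_   : (x y : Carrier) → Dec (x ≈ y)
    inv   : (x : Carrier) → ¬ (x ≈ 0#) → Σ Carrier λ y → x * y ≈ 1#

HasSize : Field → ℕ → Set
HasSize K N = Σ (Fin N → Carrier) λ e →
                ((i j : Fin N) → e i ≈ e j → i ≡ j) ×
                ((x : Carrier) → ∃ λ i → e i ≈ x)
  where open Field K

module FieldDefs (K : Field) (q : ℕ) where
  open Field K public

  pow : Carrier → ℕ → Carrier
  pow x zero    = 1#
  pow x (suc k) = x * pow x k

  Σᶠ : (m : ℕ) → (Fin m → Carrier) → Carrier
  Σᶠ zero    g = 0#
  Σᶠ (suc m) g = g Fin.zero + Σᶠ m (λ i → g (Fin.suc i))

  -- the subfield F_{q^s} = { x : x^{q^s} = x }
  InSub : ℕ → Carrier → Set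
  InSub s x = pow x (q ℕ.^ s) ≈ x

  -- a q-polynomial given by its coefficient list [c₀, c₁, …]:
  -- evalQ cs x = Σ_i c_i x^{q^i}
  evalQ : List Carrier → Carrier → Carrier
  evalQ []       x = 0#
  evalQ (c ∷ cs) x = c * x + evalQ cs (pow x q)

  InLtq : ℕ → List Carrier → Set
  InLtq t cs = All (InSub t) cs

  FqIndependent : Carrier → Carrier → Set
  FqIndependent x y = (λ₁ μ : Carrier) → InSub 1 λ₁ → InSub 1 μ →
                      λ₁ * x + μ * y ≈ 0# → (λ₁ ≈ 0#) × (μ ≈ 0#)

  -- dim_{F_q} ker(f(x) - m x) ≤ 1 on F_{q^t}, for every m ∈ F_{q^t}
  -- (the kernel contains no two F_q-linearly independent elements)
  Scattered : ℕ → List Carrier → Set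
  Scattered t cs = (m : Carrier) → InSub t m →
    ¬ (Σ Carrier λ x → Σ Carrier λ y →
         InSub t x × InSub t y ×
         (evalQ cs x - m * x ≈ 0#) × (evalQ cs y - m * y ≈ 0#) ×
         FqIndependent x y)

  IsBasis : ℕ → ℕ → Carrier → Set
  IsBasis t r ω =
    ((xs : Fin r → Carrier) → (∀ i → InSub t (xs i)) →
       Σᶠ r (λ i → xs i * pow ω (toℕ i)) ≈ 0# → ∀ i → xs i ≈ 0#) ×
    ((z : Carrier) → Σ (Fin r → Carrier) λ xs → (∀ i → InSub t (xs i)) ×
       (z ≈ Σᶠ r (λ i → xs i * pow ω (toℕ i))))

  Tr : ℕ → ℕ → Carrier → Carrier
  Tr t r x = Σᶠ r (λ j → pow x (q ℕ.^ (t ℕ.* toℕ j)))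

  Vec2 : Set
  Vec2 = Carrier × Carrier

  Nonzero : Vec2 → Set
  Nonzero (u , v) = ¬ ((u ≈ 0#) × (v ≈ 0#))

  SamePoint : Vec2 → Vec2 → Set
  SamePoint (u₁ , v₁) (u₂ , v₂) =
    Σ Carrier λ l → ¬ (l ≈ 0#) × (u₂ ≈ l * u₁) × (v₂ ≈ l * v₁)

  InLinSet : (Vec2 → Set) → Vec2 → Set
  InLinSet U P = Σ Vec2 λ w → U w × Nonzero w × SamePoint w P

  act : Carrier → Carrier → Carrier → Carrier → Vec2 → Vec2
  act α β γ δ (u , v) = (α * u + β * v , γ * u + δ * v)

  PGLEquiv : (Vec2 → Set) → (Vec2 → Set) → Set
  PGLEquiv U W = Σ Carrier λ α → Σ Carrier λ β → Σ Carrier λ γ → Σ Carrier λ δ →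
    ¬ (α * δ - β * γ ≈ 0#) ×
    ((P : Vec2) → Nonzero P → InLinSet U P → InLinSet W (act α β γ δ P)) ×
    ((Q : Vec2) → Nonzero Q → InLinSet W Q →
       Σ Vec2 λ P → Nonzero P × InLinSet U P × SamePoint (act α β γ δ P) Q)

  Uab : ℕ → ℕ → List Carrier → Carrier → Carrier → Carrier → Vec2 → Set
  Uab t r f a b ω (u , v) =
    Σ Carrier λ x₀ → Σ (Fin (r ∸ 1) → Carrier) λ xs →
      InSub t x₀ × (∀ i → InSub t (xs i)) ×
      (u ≈ evalQ f x₀ - a * x₀) ×
      (v ≈ b * x₀ + Σᶠ (r ∸ 1) (λ i → xs i * pow ω (suc (toℕ i))))

  Up : ℕ → ℕ → List Carrier → Carrier → Vec2 → Set
  Up t r f a (u , v) = v ≈ Tr t r (evalQ f u - a * u)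

{-# OPTIONS --safe #-}
module Submission where

-- Let g(x) = f(x) - a x and let β satisfy Tr(β b) = 1 and Tr(β ω^i) = 0 for 0 < i < r (β is the
-- member of the trace-dual basis of b, ω, …, ω^{r-1} belonging to b). For the second coordinate
-- z = b x₀ + Σ xᵢ ωⁱ of a vector of U_{a,b} this gives Tr(β z) = x₀, and g, being additive with
-- coefficients in F_{q^t}, commutes with the trace, so p(β z) = Tr(g(β z)) = g(Tr(β z)) = g(x₀).
-- Hence the matrix ((0, β), (1, 0)) maps (g(x₀), z) ∈ U_{a,b} to (β z, p(β z)) ∈ U_p, and every
-- vector of U_p arises this way.
-- β exists because the trace form is nondegenerate: a nonzero β₀ trace-orthogonal to ω, …, ω^{r-1}
-- solves r - 1 homogeneous F_{q^t}-linear equations in r unknowns, and Tr(β₀ b) ≠ 0, since otherwise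
-- Tr would vanish on all of F_{q^n}, impossible for a polynomial of degree q^{t(r-1)} < q^n.
-- Additivity of x ↦ x^q and x^{q^n} = x are derived from an enumeration of the field (characteristic p
-- via the binomial theorem, and Fermat's little theorem).

open import Defs

open import Level using (Level; 0ℓ)
open import Algebra.Bundles using (CommutativeRing; CommutativeMonoid)
open import Data.Nat as ℕ using (ℕ; zero; suc)
import Data.Nat.Properties as ℕ
open import Relation.Nullary using (¬_; yes; no; ¬?)
import Relation.Binary.PropositionalEquality as ≡
open import Relation.Binary.PropositionalEquality using (_≡_)
open import Data.Empty using (⊥-elim)
open import Data.Sum using (inj₁; inj₂)
open import Data.Nat.Primality using (Prime; euclidsLemma; prime⇒nonZero; prime⇒nonTrivial)
open import Data.Nat.Divisibility using (_∣_; divides; >⇒∤)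
open import Data.Fin as Fin using (Fin; toℕ; punchIn)
open import Data.List using (List; []; _∷_)
open import Data.List.Relation.Unary.All as All using (All; []; _∷_)
import Data.Fin.Properties as Fin
open import Data.Fin.Permutation using (Permutation; permutation)
open import Data.Product using (Σ; ∃; _×_; _,_; proj₁; proj₂)
open import Function using (_∘_)
import Algebra.Properties.CommutativeMonoid.Sum as CommutativeMonoidSum

-- The ring solver needs coefficients with decidable equality, which an arbitrary commutative ring
-- lacks; integers are mapped in by n ↦ n · 1#.
module IntegerCoefficientSolver {c ℓ : Level} (R : CommutativeRing c ℓ) where
  open import Data.Integer as ℤ using (ℤ; +_; -[1+_]; _⊖_; _◃_; sign; ∣_∣)
  import Data.Integer.Properties as ℤ
  open import Data.Sign as Sign using (Sign)
  open import Data.Maybe using (Maybe; just; nothing)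
  open CommutativeRing R
  open import Algebra.Properties.Ring ring using (-0#≈0#; -‿involutive; -‿distribˡ-*; -‿distribʳ-*)
  open import Algebra.Properties.AbelianGroup +-abelianGroup using (⁻¹-∙-comm)
  open import Algebra.Properties.Semiring.Mult semiring using (×-homo-+; ×1-homo-*) renaming (_×_ to _·_)
  open import Algebra.Solver.Ring.AlmostCommutativeRing
  open import Relation.Binary.Reasoning.Setoid setoid

  ⟦_⟧ : ℤ → Carrier
  ⟦ + n ⟧      = n · 1#
  ⟦ -[1+ n ] ⟧ = - (suc n · 1#)

  signed : Sign → Carrier → Carrier
  signed Sign.+ x = x
  signed Sign.- x = - x

  signed-cong : ∀ s {x y} → x ≈ y → signed s x ≈ signed s y
  signed-cong Sign.+ x≈y = x≈y
  signed-cong Sign.- x≈y = -‿cong x≈y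

  signed-* : ∀ s t x y → signed (s Sign.* t) (x * y) ≈ signed s x * signed t y
  signed-* Sign.+ Sign.+ x y = refl
  signed-* Sign.+ Sign.- x y = -‿distribʳ-* x y
  signed-* Sign.- Sign.+ x y = -‿distribˡ-* x y
  signed-* Sign.- Sign.- x y = begin
    x * y           ≈⟨ -‿involutive (x * y) ⟨
    - (- (x * y))   ≈⟨ -‿cong (-‿distribˡ-* x y) ⟩
    - (- x * y)     ≈⟨ -‿distribʳ-* (- x) y ⟩
    - x * - y       ∎

  ◃-homo : ∀ s n → ⟦ s ◃ n ⟧ ≈ signed s (n · 1#)
  ◃-homo Sign.+ zero    = refl
  ◃-homo Sign.- zero    = sym -0#≈0#
  ◃-homo Sign.+ (suc n) = refl
  ◃-homo Sign.- (suc n) = refl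

  sign-abs : ∀ i → ⟦ i ⟧ ≈ signed (sign i) (∣ i ∣ · 1#)
  sign-abs i = trans (reflexive (≡.cong ⟦_⟧ (≡.sym (ℤ.◃-inverse i)))) (◃-homo (sign i) ∣ i ∣)

  ⊖-homo : ∀ m n → ⟦ m ⊖ n ⟧ ≈ m · 1# - n · 1#
  ⊖-homo zero    zero    = sym (-‿inverseʳ 0#)
  ⊖-homo (suc m) zero    = sym (trans (+-congˡ -0#≈0#) (+-identityʳ _))
  ⊖-homo zero    (suc n) = sym (+-identityˡ _)
  ⊖-homo (suc m) (suc n) = begin
    ⟦ suc m ⊖ suc n ⟧                    ≡⟨ ≡.cong ⟦_⟧ (ℤ.[1+m]⊖[1+n]≡m⊖n m n) ⟩
    ⟦ m ⊖ n ⟧                            ≈⟨ ⊖-homo m n ⟩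
    m · 1# - n · 1#                      ≈⟨ +-identityˡ _ ⟨
    0# + (m · 1# - n · 1#)               ≈⟨ +-congʳ (-‿inverseʳ 1#) ⟨
    (1# - 1#) + (m · 1# - n · 1#)        ≈⟨ +-assoc 1# (- 1#) _ ⟩
    1# + (- 1# + (m · 1# - n · 1#))      ≈⟨ +-congˡ (+-comm _ _) ⟩
    1# + ((m · 1# - n · 1#) + - 1#)      ≈⟨ +-congˡ (+-assoc _ _ _) ⟩
    1# + (m · 1# + (- n · 1# + - 1#))    ≈⟨ +-assoc 1# _ _ ⟨
    suc m · 1# + (- n · 1# + - 1#)       ≈⟨ +-congˡ (⁻¹-∙-comm (n · 1#) 1#) ⟩
    suc m · 1# - (n · 1# + 1#)           ≈⟨ +-congˡ (-‿cong (+-comm _ _)) ⟩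
    suc m · 1# - suc n · 1#              ∎

  +-homo : ∀ i j → ⟦ i ℤ.+ j ⟧ ≈ ⟦ i ⟧ + ⟦ j ⟧
  +-homo (+ m)      (+ n)      = ×-homo-+ 1# m n
  +-homo (+ m)      -[1+ n ]   = ⊖-homo m (suc n)
  +-homo -[1+ m ]   (+ n)      = trans (⊖-homo n (suc m)) (+-comm _ _)
  +-homo -[1+ m ]   -[1+ n ]   = begin
    - (suc (suc (m ℕ.+ n)) · 1#)           ≡⟨ ≡.cong (λ k → - (suc k · 1#)) (ℕ.+-suc m n) ⟨
    - ((suc m ℕ.+ suc n) · 1#)             ≈⟨ -‿cong (×-homo-+ 1# (suc m) (suc n)) ⟩
    - (suc m · 1# + suc n · 1#)            ≈⟨ ⁻¹-∙-comm _ _ ⟨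
    - (suc m · 1#) + - (suc n · 1#)        ∎

  *-homo : ∀ i j → ⟦ i ℤ.* j ⟧ ≈ ⟦ i ⟧ * ⟦ j ⟧
  *-homo i j = begin
    ⟦ i ℤ.* j ⟧                                              ≈⟨ ◃-homo (sign i Sign.* sign j) (∣ i ∣ ℕ.* ∣ j ∣) ⟩
    signed (sign i Sign.* sign j) ((∣ i ∣ ℕ.* ∣ j ∣) · 1#)   ≈⟨ signed-cong (sign i Sign.* sign j) (×1-homo-* ∣ i ∣ ∣ j ∣) ⟩
    signed (sign i Sign.* sign j) (∣ i ∣ · 1# * ∣ j ∣ · 1#)  ≈⟨ signed-* (sign i) (sign j) _ _ ⟩
    signed (sign i) (∣ i ∣ · 1#) * signed (sign j) (∣ j ∣ · 1#)  ≈⟨ *-cong (sign-abs i) (sign-abs j) ⟨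
    ⟦ i ⟧ * ⟦ j ⟧                                            ∎

  -‿homo : ∀ i → ⟦ ℤ.- i ⟧ ≈ - ⟦ i ⟧
  -‿homo (+ zero)  = sym -0#≈0#
  -‿homo (+ suc n) = refl
  -‿homo -[1+ n ]  = sym (-‿involutive _)

  ℤ⟶R : ℤ.+-*-rawRing -Raw-AlmostCommutative⟶ fromCommutativeRing R
  ℤ⟶R = record
    { ⟦_⟧ = ⟦_⟧ ; +-homo = +-homo ; *-homo = *-homo ; -‿homo = -‿homo
    ; 0-homo = refl ; 1-homo = +-identityʳ 1# }

  ⟦⟧-weaklyDec : ∀ i j → Maybe (⟦ i ⟧ ≈ ⟦ j ⟧)
  ⟦⟧-weaklyDec i j with i ℤ.≟ j
  ... | yes ≡.refl = just refl
  ... | no _       = nothing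

  open import Algebra.Solver.Ring ℤ.+-*-rawRing (fromCommutativeRing R) ℤ⟶R ⟦⟧-weaklyDec public
    using (solve; _:=_; _:+_; _:*_; :-_; _:-_)


module _ where
  open import Data.Nat using (_*_; _<_; _+_)
  open import Data.Nat.Combinatorics using (_C_; nCk+nC[k+1]≡[n+1]C[k+1])
  open import Data.Nat.Combinatorics.Specification using (k>n⇒nCk≡0)
  open ≡.≡-Reasoning

  [k+1]*[n+1]C[k+1]≡[n+1]*nCk : ∀ n k → suc k * (suc n C suc k) ≡ suc n * (n C k)
  [k+1]*[n+1]C[k+1]≡[n+1]*nCk zero zero = ≡.refl
  [k+1]*[n+1]C[k+1]≡[n+1]*nCk zero (suc k)
    rewrite k>n⇒nCk≡0 {1} {suc (suc k)} (ℕ.s≤s (ℕ.s≤s ℕ.z≤n)) | k>n⇒nCk≡0 {0} {suc k} (ℕ.s≤s ℕ.z≤n)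
    = ℕ.*-zeroʳ (suc (suc k))
  [k+1]*[n+1]C[k+1]≡[n+1]*nCk (suc n) k = begin
    suc k * (suc (suc n) C suc k)               ≡⟨ ≡.cong (suc k *_) (nCk+nC[k+1]≡[n+1]C[k+1] (suc n) k) ⟨
    suc k * (X + suc n C suc k)                 ≡⟨ ℕ.*-distribˡ-+ (suc k) X _ ⟩
    suc k * X + suc k * (suc n C suc k)         ≡⟨ ≡.cong (_+_ (suc k * X)) ([k+1]*[n+1]C[k+1]≡[n+1]*nCk n k) ⟩
    (X + k * X) + suc n * (n C k)               ≡⟨ ℕ.+-assoc X (k * X) _ ⟩
    X + (k * X + suc n * (n C k))               ≡⟨ ≡.cong (_+_ X) (k*X+[n+1]*nCk k) ⟩
    X + suc n * X                               ∎
    where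
    X = suc n C k
    k*X+[n+1]*nCk : ∀ k → k * (suc n C k) + suc n * (n C k) ≡ suc n * (suc n C k)
    k*X+[n+1]*nCk zero    = ≡.refl
    k*X+[n+1]*nCk (suc k) = begin
      suc k * (suc n C suc k) + suc n * (n C suc k) ≡⟨ ≡.cong (_+ suc n * (n C suc k)) ([k+1]*[n+1]C[k+1]≡[n+1]*nCk n k) ⟩
      suc n * (n C k) + suc n * (n C suc k)         ≡⟨ ℕ.*-distribˡ-+ (suc n) (n C k) _ ⟨
      suc n * (n C k + n C suc k)                   ≡⟨ ≡.cong (suc n *_) (nCk+nC[k+1]≡[n+1]C[k+1] n k) ⟩
      suc n * (suc n C suc k)                       ∎

  p∣pCk : ∀ {p k} → Prime p → 0 < k → k < p → p ∣ p C k
  p∣pCk {suc n} {suc k} p-prime _ k<p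
    with euclidsLemma (suc k) (suc n C suc k) p-prime
           (divides (n C k) (≡.trans ([k+1]*[n+1]C[k+1]≡[n+1]*nCk n k) (ℕ.*-comm (suc n) (n C k))))
  ... | inj₁ p∣k   = ⊥-elim (>⇒∤ k<p p∣k)
  ... | inj₂ p∣pCk = p∣pCk

module FieldTheory (K : Field) (q : ℕ) where
  -- q only matters from the Frobenius section on, but pow and Σᶠ live in FieldDefs K q.
  open FieldDefs K q
  open IntegerCoefficientSolver cring using (solve; _:=_; _:+_; _:*_; :-_; _:-_)
  open import Algebra.Properties.Group +-group using (x∙y⁻¹≈ε⇒x≈y; inverseˡ-unique)
  open import Algebra.Properties.Ring ring using (-0#≈0#; -‿involutive)
  open import Algebra.Properties.Semiring.Sum semiring
    using (sum; sum-cong-≋; ∑-distrib-+; sum-replicate; sum-replicate-zero; sum-init-last; *-distribˡ-sum; *-distribʳ-sum)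
  open import Algebra.Properties.Semiring.Mult semiring using () renaming (_×_ to _·_)
  open import Algebra.Properties.CommutativeSemiring.Exp commutativeSemiring
    using (_^_; ^-congˡ; ^-assocʳ; ^-distrib-*)
  open import Relation.Binary.Reasoning.Setoid setoid

  1#≉0# : 1# ≉ 0#
  1#≉0# 1≈0 = 0≉1 (sym 1≈0)

  inverse : ∀ x → x ≉ 0# → Carrier
  inverse x x≉0 = proj₁ (inv x x≉0)

  inverseʳ : ∀ x (x≉0 : x ≉ 0#) → x * inverse x x≉0 ≈ 1#
  inverseʳ x x≉0 = proj₂ (inv x x≉0)

  inverseˡ : ∀ x (x≉0 : x ≉ 0#) → inverse x x≉0 * x ≈ 1#
  inverseˡ x x≉0 = trans (*-comm _ x) (inverseʳ x x≉0)

  inverse-cancelˡ : ∀ x (x≉0 : x ≉ 0#) y → inverse x x≉0 * (x * y) ≈ y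
  inverse-cancelˡ x x≉0 y = begin
    inverse x x≉0 * (x * y)  ≈⟨ *-assoc _ x y ⟨
    inverse x x≉0 * x * y    ≈⟨ *-congʳ (inverseˡ x x≉0) ⟩
    1# * y                   ≈⟨ *-identityˡ y ⟩
    y                        ∎

  inverse-cancelʳ : ∀ x (x≉0 : x ≉ 0#) y → x * (inverse x x≉0 * y) ≈ y
  inverse-cancelʳ x x≉0 y = begin
    x * (inverse x x≉0 * y)  ≈⟨ *-assoc x _ y ⟨
    x * inverse x x≉0 * y    ≈⟨ *-congʳ (inverseʳ x x≉0) ⟩
    1# * y                   ≈⟨ *-identityˡ y ⟩
    y                        ∎

  x*y≈0⇒y≈0 : ∀ {x y} → x ≉ 0# → x * y ≈ 0# → y ≈ 0#
  x*y≈0⇒y≈0 {x} {y} x≉0 xy≈0 = begin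
    y                        ≈⟨ inverse-cancelˡ x x≉0 y ⟨
    inverse x x≉0 * (x * y)  ≈⟨ *-congˡ xy≈0 ⟩
    inverse x x≉0 * 0#       ≈⟨ zeroʳ _ ⟩
    0#                       ∎

  x*y≉0 : ∀ {x y} → x ≉ 0# → y ≉ 0# → x * y ≉ 0#
  x*y≉0 x≉0 y≉0 = y≉0 ∘ x*y≈0⇒y≈0 x≉0

  inverse≉0 : ∀ x (x≉0 : x ≉ 0#) → inverse x x≉0 ≉ 0#
  inverse≉0 x x≉0 x⁻¹≈0 = 1#≉0# (begin
    1#                  ≈⟨ inverseʳ x x≉0 ⟨
    x * inverse x x≉0   ≈⟨ *-congˡ x⁻¹≈0 ⟩
    x * 0#              ≈⟨ zeroʳ x ⟩
    0#                  ∎)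

  Σᶠ≡sum : ∀ m (f : Fin m → Carrier) → Σᶠ m f ≡ sum f
  Σᶠ≡sum zero    f = ≡.refl
  Σᶠ≡sum (suc m) f = ≡.cong (_+_ (f Fin.zero)) (Σᶠ≡sum m (f ∘ Fin.suc))

  sum-last : ∀ m (h : ℕ → Carrier) → sum {suc m} (λ j → h (toℕ j)) ≈ sum {m} (λ j → h (toℕ j)) + h m
  sum-last m h = begin
    sum {suc m} (λ j → h (toℕ j))                                   ≈⟨ sum-init-last {m} (λ j → h (toℕ j)) ⟩
    sum {m} (λ j → h (toℕ (Fin.inject₁ j))) + h (toℕ (Fin.fromℕ m)) ≈⟨ +-cong
                                                                         (sum-cong-≋ {m} (λ j → reflexive (≡.cong h (Fin.toℕ-inject₁ j))))
                                                                         (reflexive (≡.cong h (Fin.toℕ-fromℕ m))) ⟩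
    sum {m} (λ j → h (toℕ j)) + h m                                 ∎

  sum≈0 : ∀ {m} {f : Fin m → Carrier} → (∀ i → f i ≈ 0#) → sum f ≈ 0#
  sum≈0 {m} f≈0 = trans (sum-cong-≋ f≈0) (sum-replicate-zero m)

  x+y≈z+x⇒y≈z : ∀ {x y z} → x + y ≈ z + x → y ≈ z
  x+y≈z+x⇒y≈z {x} {y} {z} x+y≈z+x = begin
    y              ≈⟨ solve 2 (λ x y → y := (x :+ y) :- x) refl x y ⟩
    (x + y) - x    ≈⟨ +-congʳ x+y≈z+x ⟩
    (z + x) - x    ≈⟨ solve 2 (λ x z → (z :+ x) :- x := z) refl x z ⟩
    z              ∎

  x+y≈x⇒y≈0 : ∀ {x y} → x + y ≈ x → y ≈ 0#
  x+y≈x⇒y≈0 {x} x+y≈x = x+y≈z+x⇒y≈z (trans x+y≈x (sym (+-identityˡ x)))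

  x*y≈y⇒x≈1 : ∀ {x y} → y ≉ 0# → x * y ≈ y → x ≈ 1#
  x*y≈y⇒x≈1 {x} {y} y≉0 xy≈y = x∙y⁻¹≈ε⇒x≈y x 1# (x*y≈0⇒y≈0 y≉0 (begin
    y * (x - 1#)     ≈⟨ solve 3 (λ x y o → y :* (x :- o) := x :* y :- y :* o) refl x y 1# ⟩
    x * y - y * 1#   ≈⟨ +-cong xy≈y (-‿cong (*-identityʳ y)) ⟩
    y - y            ≈⟨ -‿inverseʳ y ⟩
    0#               ∎))

  record IsAdditive (h : Carrier → Carrier) : Set where
    field
      cong   : ∀ {x y} → x ≈ y → h x ≈ h y
      +-homo : ∀ x y → h (x + y) ≈ h x + h y

    0-homo : h 0# ≈ 0#
    0-homo = x+y≈x⇒y≈0 (begin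
      h 0# + h 0#   ≈⟨ +-homo 0# 0# ⟨
      h (0# + 0#)   ≈⟨ cong (+-identityˡ 0#) ⟩
      h 0#          ∎)

    -‿homo : ∀ x → h (- x) ≈ - h x
    -‿homo x = inverseˡ-unique (h (- x)) (h x) (begin
      h (- x) + h x  ≈⟨ +-homo (- x) x ⟨
      h (- x + x)    ≈⟨ cong (-‿inverseˡ x) ⟩
      h 0#           ≈⟨ 0-homo ⟩
      0#             ∎)

    sum-homo : ∀ {m} (f : Fin m → Carrier) → h (sum f) ≈ sum (h ∘ f)
    sum-homo {zero}  f = 0-homo
    sum-homo {suc m} f = trans (+-homo _ _) (+-congˡ (sum-homo (f ∘ Fin.suc)))

  open IsAdditive

  IsAdditive-sum : ∀ {m} {hs : Fin m → Carrier → Carrier} → (∀ j → IsAdditive (hs j)) →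
                   IsAdditive (λ x → sum (λ j → hs j x))
  IsAdditive-sum {hs = hs} hs-additive = record
    { cong   = λ x≈y → sum-cong-≋ (λ j → cong (hs-additive j) x≈y)
    ; +-homo = λ x y → trans (sum-cong-≋ (λ j → +-homo (hs-additive j) x y)) (∑-distrib-+ (λ j → hs j x) (λ j → hs j y))
    }

  IsAdditive-scale : ∀ c → IsAdditive (c *_)
  IsAdditive-scale c = record { cong = *-congˡ ; +-homo = distribˡ c }

  IsAdditive-- : ∀ {f g} → IsAdditive f → IsAdditive g → IsAdditive (λ x → f x - g x)
  IsAdditive-- {f} {g} f-additive g-additive = record
    { cong   = λ x≈y → +-cong (cong f-additive x≈y) (-‿cong (cong g-additive x≈y))
    ; +-homo = λ x y → begin
        f (x + y) - g (x + y)            ≈⟨ +-cong (+-homo f-additive x y) (-‿cong (+-homo g-additive x y)) ⟩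
        (f x + f y) - (g x + g y)        ≈⟨ solve 4 (λ a b c d → (a :+ b) :- (c :+ d) := (a :- c) :+ (b :- d)) refl _ _ _ _ ⟩
        (f x - g x) + (f y - g y)        ∎
    }

  IsAdditive-id : IsAdditive (λ x → x)
  IsAdditive-id = record { cong = λ x≈y → x≈y ; +-homo = λ _ _ → refl }

  IsAdditive-+ : ∀ {f g} → IsAdditive f → IsAdditive g → IsAdditive (λ x → f x + g x)
  IsAdditive-+ {f} {g} f-additive g-additive = record
    { cong   = λ x≈y → +-cong (cong f-additive x≈y) (cong g-additive x≈y)
    ; +-homo = λ x y → begin
        f (x + y) + g (x + y)            ≈⟨ +-cong (+-homo f-additive x y) (+-homo g-additive x y) ⟩
        (f x + f y) + (g x + g y)        ≈⟨ solve 4 (λ a b c d → (a :+ b) :+ (c :+ d) := (a :+ c) :+ (b :+ d)) refl _ _ _ _ ⟩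
        (f x + g x) + (f y + g y)        ∎
    }

  IsAdditive-resp : ∀ {f g} → (∀ x → f x ≈ g x) → IsAdditive f → IsAdditive g
  IsAdditive-resp {f} {g} f≈g f-additive = record
    { cong   = λ {x} {y} x≈y → trans (sym (f≈g x)) (trans (cong f-additive x≈y) (f≈g y))
    ; +-homo = λ x y → trans (sym (f≈g (x + y))) (trans (+-homo f-additive x y) (+-cong (f≈g x) (f≈g y)))
    }

  IsAdditive-∘ : ∀ {f g} → IsAdditive f → IsAdditive g → IsAdditive (f ∘ g)
  IsAdditive-∘ f-additive g-additive = record
    { cong   = cong f-additive ∘ cong g-additive
    ; +-homo = λ x y → trans (cong f-additive (+-homo g-additive x y)) (+-homo f-additive _ _)
    }

  pow≡^ : ∀ x n → pow x n ≡ x ^ n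
  pow≡^ x zero    = ≡.refl
  pow≡^ x (suc n) = ≡.cong (x *_) (pow≡^ x n)

  pow-cong : ∀ {x y} n → x ≈ y → pow x n ≈ pow y n
  pow-cong {x} {y} n x≈y rewrite pow≡^ x n | pow≡^ y n = ^-congˡ n x≈y

  pow-assoc : ∀ x m n → pow (pow x m) n ≈ pow x (m ℕ.* n)
  pow-assoc x m n rewrite pow≡^ (pow x m) n | pow≡^ x m | pow≡^ x (m ℕ.* n) = ^-assocʳ x m n

  pow-distrib-* : ∀ x y n → pow (x * y) n ≈ pow x n * pow y n
  pow-distrib-* x y n rewrite pow≡^ (x * y) n | pow≡^ x n | pow≡^ y n = ^-distrib-* x y n

  pow-1# : ∀ n → pow 1# n ≈ 1#
  pow-1# zero    = refl
  pow-1# (suc n) = trans (*-identityˡ _) (pow-1# n)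

  pow≉0 : ∀ {x} n → x ≉ 0# → pow x n ≉ 0#
  pow≉0 zero    x≉0 = 1#≉0#
  pow≉0 (suc n) x≉0 = x*y≉0 x≉0 (pow≉0 n x≉0)

  ·1#-^ : ∀ m e → (m ℕ.^ e) · 1# ≈ pow (m · 1#) e
  ·1#-^ m zero    = +-identityʳ 1#
  ·1#-^ m (suc e) = trans (×1-homo-* m (m ℕ.^ e)) (*-congˡ (·1#-^ m e))
    where open import Algebra.Properties.Semiring.Mult semiring using (×1-homo-*)

  ^·1#≈0⇒·1#≈0 : ∀ m e → (m ℕ.^ e) · 1# ≈ 0# → m · 1# ≈ 0#
  ^·1#≈0⇒·1#≈0 m e mᵉ≈0 with (m · 1#) ≟ 0#
  ... | yes m≈0 = m≈0
  ... | no m≉0  = ⊥-elim (pow≉0 e m≉0 (trans (sym (·1#-^ m e)) mᵉ≈0))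

  -- Characteristic p

  module _ where
    open import Algebra.Properties.CommutativeSemiring.Binomial commutativeSemiring
      using (binomialTerm; theorem)
    open import Algebra.Properties.Semiring.Mult semiring using (×1-homo-*; ×-assoc-*; ×-homo-1; ×-congʳ)
    open import Data.Nat.Combinatorics using (_C_; nCn≡1)

    multiple-of-char≈0 : ∀ {p} → p · 1# ≈ 0# → ∀ c b → (c ℕ.* p) · b ≈ 0#
    multiple-of-char≈0 {p} char c b = begin
      (c ℕ.* p) · b                 ≈⟨ ×-congʳ (c ℕ.* p) (*-identityˡ b) ⟨
      (c ℕ.* p) · (1# * b)          ≈⟨ ×-assoc-* (c ℕ.* p) 1# b ⟨
      ((c ℕ.* p) · 1#) * b          ≈⟨ *-congʳ (×1-homo-* c p) ⟩
      (c · 1#) * (p · 1#) * b       ≈⟨ *-congʳ (*-congˡ char) ⟩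
      (c · 1#) * 0# * b             ≈⟨ trans (*-congʳ (zeroʳ _)) (zeroˡ b) ⟩
      0#                            ∎

    freshmans-dream : ∀ {p} → Prime p → p · 1# ≈ 0# → ∀ x y → pow (x + y) p ≈ pow x p + pow y p
    freshmans-dream {zero}  p-prime = ⊥-elim (ℕ.NonZero.nonZero (prime⇒nonZero p-prime))
    freshmans-dream {suc m} p-prime char x y = begin
      pow (x + y) p                                           ≡⟨ pow≡^ (x + y) p ⟩
      (x + y) ^ p                                             ≈⟨ theorem p x y ⟩
      t Fin.zero + sum (t ∘ Fin.suc)                          ≈⟨ +-congˡ (sum-init-last (t ∘ Fin.suc)) ⟩
      t Fin.zero + (sum (t ∘ Fin.suc ∘ Fin.inject₁) + t (Fin.fromℕ p))
                                                              ≈⟨ +-congˡ (+-congʳ (sum≈0 middle)) ⟩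
      t Fin.zero + (0# + t (Fin.fromℕ p))                     ≈⟨ +-congˡ (+-identityˡ _) ⟩
      t Fin.zero + t (Fin.fromℕ p)                            ≈⟨ +-comm _ _ ⟩
      t (Fin.fromℕ p) + t Fin.zero                            ≈⟨ +-cong last first ⟩
      pow x p + pow y p                                       ∎
      where
      p = suc m

      t : Fin (suc p) → Carrier
      t = binomialTerm x y p

      first : t Fin.zero ≈ pow y p
      first = trans (×-homo-1 _) (trans (*-identityˡ _) (reflexive (≡.sym (pow≡^ y p))))

      last : t (Fin.fromℕ p) ≈ pow x p
      last = begin
        t (Fin.fromℕ p)                  ≡⟨ ≡.cong (λ k → (p C k) · (x ^ k * y ^ (p ℕ.∸ k))) (Fin.toℕ-fromℕ p) ⟩
        (p C p) · (x ^ p * y ^ (p ℕ.∸ p)) ≡⟨ ≡.cong₂ (λ c e → c · (x ^ p * y ^ e)) (nCn≡1 p) (ℕ.n∸n≡0 p) ⟩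
        1 · (x ^ p * 1#)                  ≈⟨ trans (×-homo-1 _) (*-identityʳ _) ⟩
        x ^ p                             ≡⟨ pow≡^ x p ⟨
        pow x p                           ∎

      middle : (i : Fin m) → t (Fin.suc (Fin.inject₁ i)) ≈ 0#
      middle i with p∣pCk p-prime (ℕ.s≤s ℕ.z≤n)
                      (ℕ.s≤s (≡.subst (ℕ._< m) (≡.sym (Fin.toℕ-inject₁ i)) (Fin.toℕ<n i)))
      ... | divides c pCk≡c*p rewrite pCk≡c*p = multiple-of-char≈0 char c _

  pow-^-additive : ∀ {m} → IsAdditive (λ x → pow x m) → ∀ k → IsAdditive (λ x → pow x (m ℕ.^ k))
  pow-^-additive m-additive zero    = IsAdditive-resp (λ x → sym (*-identityʳ x)) IsAdditive-id
  pow-^-additive {m} m-additive (suc k) =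
    IsAdditive-resp (λ x → pow-assoc x m (m ℕ.^ k)) (IsAdditive-∘ (pow-^-additive m-additive k) m-additive)

  pow-prime-additive : ∀ {p} → Prime p → p · 1# ≈ 0# → IsAdditive (λ x → pow x p)
  pow-prime-additive {p} p-prime char = record { cong = pow-cong p ; +-homo = freshmans-dream p-prime char }

  -- Finite fields

  module ∏ = CommutativeMonoidSum *-commutativeMonoid

  ∏≉0 : ∀ {m} (f : Fin m → Carrier) → (∀ i → f i ≉ 0#) → ∏.sum f ≉ 0#
  ∏≉0 {zero}  f f≉0 = 1#≉0#
  ∏≉0 {suc m} f f≉0 = x*y≉0 (f≉0 Fin.zero) (∏≉0 (f ∘ Fin.suc) (f≉0 ∘ Fin.suc))

  unitPart : Carrier → Carrier
  unitPart y with y ≟ 0#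
  ... | yes _ = 1#
  ... | no _  = y

  scaleFactor : Carrier → Carrier → Carrier
  scaleFactor x y with y ≟ 0#
  ... | yes _ = 1#
  ... | no _  = x

  unitPart≉0 : ∀ y → unitPart y ≉ 0#
  unitPart≉0 y with y ≟ 0#
  ... | yes _  = 1#≉0#
  ... | no y≉0 = y≉0

  unitPart-cong : ∀ {y z} → y ≈ z → unitPart y ≈ unitPart z
  unitPart-cong {y} {z} y≈z with y ≟ 0# | z ≟ 0#
  ... | yes _   | yes _   = refl
  ... | yes y≈0 | no z≉0  = ⊥-elim (z≉0 (trans (sym y≈z) y≈0))
  ... | no y≉0  | yes z≈0 = ⊥-elim (y≉0 (trans y≈z z≈0))
  ... | no _    | no _    = y≈z

  unitPart-* : ∀ {x} → x ≉ 0# → ∀ y → unitPart (x * y) ≈ scaleFactor x y * unitPart y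
  unitPart-* {x} x≉0 y with y ≟ 0# | (x * y) ≟ 0#
  ... | yes _   | yes _    = sym (*-identityˡ 1#)
  ... | yes y≈0 | no xy≉0  = ⊥-elim (xy≉0 (trans (*-congˡ y≈0) (zeroʳ x)))
  ... | no y≉0  | yes xy≈0 = ⊥-elim (x*y≉0 x≉0 y≉0 xy≈0)
  ... | no _    | no _     = refl

  scaleFactor-0 : ∀ {x y} → y ≈ 0# → scaleFactor x y ≈ 1#
  scaleFactor-0 {x} {y} y≈0 with y ≟ 0#
  ... | yes _  = refl
  ... | no y≉0 = ⊥-elim (y≉0 y≈0)

  scaleFactor-≉0 : ∀ {x y} → y ≉ 0# → scaleFactor x y ≈ x
  scaleFactor-≉0 {x} {y} y≉0 with y ≟ 0#
  ... | yes y≈0 = ⊥-elim (y≉0 y≈0)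
  ... | no _    = refl

  module FiniteField {M : ℕ} (size : HasSize K (suc M)) where
    enum : Fin (suc M) → Carrier
    enum = proj₁ size

    index : Carrier → Fin (suc M)
    index x = proj₁ (proj₂ (proj₂ size) x)

    enum-index : ∀ x → enum (index x) ≈ x
    enum-index x = proj₂ (proj₂ (proj₂ size) x)

    index-enum : ∀ {x} i → x ≈ enum i → index x ≡ i
    index-enum {x} i x≈eᵢ = proj₁ (proj₂ size) (index x) i (trans (enum-index x) x≈eᵢ)

    module _ (φ ψ : Carrier → Carrier)
             (φ-cong : ∀ {x y} → x ≈ y → φ x ≈ φ y) (ψ-cong : ∀ {x y} → x ≈ y → ψ x ≈ ψ y)
             (φ∘ψ : ∀ x → φ (ψ x) ≈ x) (ψ∘φ : ∀ x → ψ (φ x) ≈ x) where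

      reindexing : Permutation (suc M) (suc M)
      reindexing = permutation (index ∘ φ ∘ enum) (index ∘ ψ ∘ enum)
        (λ i → index-enum i (trans (φ-cong (enum-index _)) (φ∘ψ _)))
        (λ i → index-enum i (trans (ψ-cong (enum-index _)) (ψ∘φ _)))

      sum-reindex : (C : CommutativeMonoid 0ℓ 0ℓ) (G : Carrier → CommutativeMonoid.Carrier C) →
                    (∀ {x y} → x ≈ y → CommutativeMonoid._≈_ C (G x) (G y)) →
                    CommutativeMonoid._≈_ C (CommutativeMonoidSum.sum C (G ∘ enum))
                                            (CommutativeMonoidSum.sum C (G ∘ φ ∘ enum))
      sum-reindex C G G-cong = CommutativeMonoid.trans C (S.sum-permute (G ∘ enum) reindexing)
                                 (S.sum-cong-≋ {suc M} (λ i → G-cong (enum-index (φ (enum i)))))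
        where module S = CommutativeMonoidSum C

    -- Translation by 1 permutes K.
    characteristic : suc M · 1# ≈ 0#
    characteristic = x+y≈x⇒y≈0 (begin
      sum enum + suc M · 1#            ≈⟨ +-congˡ (sum-replicate (suc M)) ⟨
      sum enum + sum {suc M} (λ _ → 1#) ≈⟨ ∑-distrib-+ enum (λ _ → 1#) ⟨
      sum (λ i → enum i + 1#)          ≈⟨ sum-reindex (_+ 1#) (_- 1#) +-congʳ +-congʳ
                                           (λ y → solve 2 (λ y o → (y :- o) :+ o := y) refl y 1#)
                                           (λ y → solve 2 (λ y o → (y :+ o) :- o := y) refl y 1#)
                                           +-commutativeMonoid (λ y → y) (λ y≈z → y≈z) ⟨
      sum enum                         ∎)

    ∏-scaleFactor : ∀ x → ∏.sum (scaleFactor x ∘ enum) ≈ pow x M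
    ∏-scaleFactor x = begin
      ∏.sum (scaleFactor x ∘ enum)                      ≈⟨ ∏.sum-remove {i = i₀} (scaleFactor x ∘ enum) ⟩
      scaleFactor x (enum i₀) * ∏.sum {M} (λ j → scaleFactor x (enum (punchIn i₀ j)))
                                                        ≈⟨ *-cong (scaleFactor-0 (enum-index 0#)) (∏.sum-cong-≋ {M} at-nonzero) ⟩
      1# * ∏.sum {M} (λ _ → x)                          ≈⟨ *-identityˡ _ ⟩
      ∏.sum {M} (λ _ → x)                               ≈⟨ ∏.sum-replicate M ⟩
      x ^ M                                             ≡⟨ pow≡^ x M ⟨
      pow x M                                           ∎
      where
      i₀ = index 0#

      at-nonzero : ∀ j → scaleFactor x (enum (punchIn i₀ j)) ≈ x
      at-nonzero j = scaleFactor-≉0 λ e≈0 → Fin.punchInᵢ≢i i₀ j (≡.sym (index-enum _ (sym e≈0)))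

    -- Multiplication by x permutes K, and multiplies the product of unitPart over K by x^M.
    fermat-unit : ∀ {x} → x ≉ 0# → pow x M ≈ 1#
    fermat-unit {x} x≉0 = x*y≈y⇒x≈1 (∏≉0 (unitPart ∘ enum) (unitPart≉0 ∘ enum)) (begin
      pow x M * P                                                 ≈⟨ *-congʳ (∏-scaleFactor x) ⟨
      ∏.sum (scaleFactor x ∘ enum) * P                            ≈⟨ ∏.∑-distrib-+ (scaleFactor x ∘ enum) (unitPart ∘ enum) ⟨
      ∏.sum (λ i → scaleFactor x (enum i) * unitPart (enum i))    ≈⟨ ∏.sum-cong-≋ {suc M} (λ i → unitPart-* x≉0 (enum i)) ⟨
      ∏.sum (λ i → unitPart (x * enum i))                         ≈⟨ sum-reindex (x *_) (inverse x x≉0 *_) *-congˡ *-congˡ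
                                                                       (inverse-cancelʳ x x≉0) (inverse-cancelˡ x x≉0)
                                                                       *-commutativeMonoid unitPart unitPart-cong ⟨
      P                                                           ∎)
      where
      P = ∏.sum (unitPart ∘ enum)

    fermat : ∀ x → pow x (suc M) ≈ x
    fermat x with x ≟ 0#
    ... | yes x≈0 = trans (pow-cong (suc M) x≈0) (trans (zeroˡ _) (sym x≈0))
    ... | no x≉0  = trans (*-congˡ (fermat-unit x≉0)) (*-identityʳ x)

  HasSize-suc : ∀ {N} → HasSize K N → Σ ℕ λ M → N ≡ suc M
  HasSize-suc {zero}  (_ , _ , onto) with onto 0#
  ... | () , _
  HasSize-suc {suc M} _ = M , ≡.refl

  module OfPrimePowerOrder {p k n : ℕ} (p-prime : Prime p) (q≡pᵏ : q ≡ p ℕ.^ k) (size : HasSize K (q ℕ.^ n)) where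

    M : ℕ
    M = proj₁ (HasSize-suc size)

    qⁿ≡1+M : q ℕ.^ n ≡ suc M
    qⁿ≡1+M = proj₂ (HasSize-suc size)

    open FiniteField (≡.subst (HasSize K) qⁿ≡1+M size) using (characteristic; fermat)

    char-p : p · 1# ≈ 0#
    char-p = ^·1#≈0⇒·1#≈0 p (k ℕ.* n) (≡.subst (λ N → N · 1# ≈ 0#) 1+M≡pᵏⁿ characteristic)
      where
      1+M≡pᵏⁿ : suc M ≡ p ℕ.^ (k ℕ.* n)
      1+M≡pᵏⁿ = ≡.trans (≡.sym qⁿ≡1+M) (≡.trans (≡.cong (ℕ._^ n) q≡pᵏ) (ℕ.^-*-assoc p k n))

    pow-q-additive : IsAdditive (λ x → pow x q)
    pow-q-additive = ≡.subst (λ m → IsAdditive (λ x → pow x m)) (≡.sym q≡pᵏ)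
                       (pow-^-additive (pow-prime-additive p-prime char-p) k)

    fermat-qⁿ : ∀ x → pow x (q ℕ.^ n) ≈ x
    fermat-qⁿ x = ≡.subst (λ N → pow x N ≈ x) (≡.sym qⁿ≡1+M) (fermat x)

  -- Polynomial functions

  -- f agrees with a polynomial function of degree at most D whose coefficient of x^D is c,
  -- presented in Horner form.
  Polynomial : ℕ → Carrier → (Carrier → Carrier) → Set
  Polynomial zero    c f = ∀ x → f x ≈ c
  Polynomial (suc D) c f = Σ (Carrier → Carrier) λ g → Σ Carrier λ a →
                             Polynomial D c g × (∀ x → f x ≈ g x * x + a)

  Polynomial-resp : ∀ D {c f g} → (∀ x → f x ≈ g x) → Polynomial D c f → Polynomial D c g
  Polynomial-resp zero    f≈g f-poly               = λ x → trans (sym (f≈g x)) (f-poly x)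
  Polynomial-resp (suc D) f≈g (h , a , h-poly , f≈) = h , a , h-poly , (λ x → trans (sym (f≈g x)) (f≈ x))

  Polynomial-lead : ∀ D {c c′ f} → c ≈ c′ → Polynomial D c f → Polynomial D c′ f
  Polynomial-lead zero    c≈c′ f-poly               = λ x → trans (f-poly x) c≈c′
  Polynomial-lead (suc D) c≈c′ (h , a , h-poly , f≈) = h , a , Polynomial-lead D c≈c′ h-poly , f≈

  Polynomial-0 : ∀ D → Polynomial D 0# (λ _ → 0#)
  Polynomial-0 zero    = λ _ → refl
  Polynomial-0 (suc D) = (λ _ → 0#) , 0# , Polynomial-0 D , (λ x → sym (trans (+-identityʳ _) (zeroˡ x)))

  Polynomial-+ : ∀ D {c c′ f g} → Polynomial D c f → Polynomial D c′ g →
                 Polynomial D (c + c′) (λ x → f x + g x)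
  Polynomial-+ zero    f-poly g-poly = λ x → +-cong (f-poly x) (g-poly x)
  Polynomial-+ (suc D) (f′ , a , f′-poly , f≈) (g′ , b , g′-poly , g≈) =
    (λ x → f′ x + g′ x) , a + b , Polynomial-+ D f′-poly g′-poly , λ x → begin
      _ + _                              ≈⟨ +-cong (f≈ x) (g≈ x) ⟩
      (f′ x * x + a) + (g′ x * x + b)    ≈⟨ solve 5 (λ u v x a b → (u :* x :+ a) :+ (v :* x :+ b) := (u :+ v) :* x :+ (a :+ b))
                                              refl (f′ x) (g′ x) x a b ⟩
      (f′ x + g′ x) * x + (a + b)        ∎

  Polynomial-sum : ∀ D {m} (fs : Fin m → Carrier → Carrier) → (∀ i → Polynomial D 0# (fs i)) →
                   Polynomial D 0# (λ x → sum (λ i → fs i x))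
  Polynomial-sum D {zero}  fs fs-poly = Polynomial-0 D
  Polynomial-sum D {suc m} fs fs-poly = Polynomial-lead D (+-identityˡ 0#)
    (Polynomial-+ D (fs-poly Fin.zero) (Polynomial-sum D (fs ∘ Fin.suc) (fs-poly ∘ Fin.suc)))

  Polynomial-raise : ∀ D {c f} → Polynomial D c f → Polynomial (suc D) 0# f
  Polynomial-raise zero    {c} f-poly = (λ _ → 0#) , c , (λ _ → refl) ,
    (λ x → trans (f-poly x) (sym (trans (+-congʳ (zeroˡ x)) (+-identityˡ c))))
  Polynomial-raise (suc D) (g , a , g-poly , f≈) = g , a , Polynomial-raise D g-poly , f≈

  Polynomial-pow : ∀ D → Polynomial D 1# (λ x → pow x D)
  Polynomial-pow zero    = λ _ → refl
  Polynomial-pow (suc D) = (λ x → pow x D) , 0# , Polynomial-pow D ,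
    (λ x → trans (*-comm x _) (sym (+-identityʳ _)))

  Polynomial-pow< : ∀ {j} D → j ℕ.< D → Polynomial D 0# (λ x → pow x j)
  Polynomial-pow< {j} (suc D) (ℕ.s≤s j≤D) with ℕ.m≤n⇒∃[o]m+o≡n j≤D
  ... | d , ≡.refl = raise d
    where
    raise : ∀ d → Polynomial (suc (j ℕ.+ d)) 0# (λ x → pow x j)
    raise zero    rewrite ℕ.+-identityʳ j = Polynomial-raise j (Polynomial-pow j)
    raise (suc d) rewrite ℕ.+-suc j d = Polynomial-raise (suc (j ℕ.+ d)) (raise d)

  factor-theorem : ∀ D {c f} → Polynomial (suc D) c f → ∀ x₀ →
                   Σ (Carrier → Carrier) λ h → Polynomial D c h × (∀ x → f x ≈ (x - x₀) * h x + f x₀)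
  factor-theorem zero {c} {f} (g , a , g-poly , f≈) x₀ = g , g-poly , λ x → begin
    f x                           ≈⟨ f≈ x ⟩
    g x * x + a                   ≈⟨ +-congʳ (*-congʳ (trans (g-poly x) (sym (g-poly x₀)))) ⟩
    g x₀ * x + a                  ≈⟨ solve 4 (λ c x x₀ a → c :* x :+ a := (x :- x₀) :* c :+ (c :* x₀ :+ a)) refl (g x₀) x x₀ a ⟩
    (x - x₀) * g x₀ + (g x₀ * x₀ + a)  ≈⟨ +-cong (*-congˡ (trans (g-poly x₀) (sym (g-poly x)))) (sym (f≈ x₀)) ⟩
    (x - x₀) * g x + f x₀         ∎
  factor-theorem (suc D) {c} {f} (g , a , g-poly , f≈) x₀ with factor-theorem D g-poly x₀
  ... | h , h-poly , g≈ = (λ x → x * h x + g x₀) , (h , g x₀ , h-poly , λ x → +-congʳ (*-comm _ _)) , λ x → begin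
    f x                                          ≈⟨ f≈ x ⟩
    g x * x + a                                  ≈⟨ +-congʳ (*-congʳ (g≈ x)) ⟩
    ((x - x₀) * h x + g x₀) * x + a              ≈⟨ solve 5 (λ x x₀ h c a → ((x :- x₀) :* h :+ c) :* x :+ a
                                                       := (x :- x₀) :* (x :* h :+ c) :+ (c :* x₀ :+ a)) refl x x₀ (h x) (g x₀) a ⟩
    (x - x₀) * (x * h x + g x₀) + (g x₀ * x₀ + a) ≈⟨ +-congˡ (sym (f≈ x₀)) ⟩
    (x - x₀) * (x * h x + g x₀) + f x₀           ∎

  root-bound : ∀ D {c f} → c ≉ 0# → Polynomial D c f → (xs : Fin (suc D) → Carrier) →
               (∀ i j → xs i ≈ xs j → i ≡ j) → ¬ (∀ i → f (xs i) ≈ 0#)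
  root-bound zero    c≉0 f-poly xs xs-injective roots = c≉0 (trans (sym (f-poly (xs Fin.zero))) (roots Fin.zero))
  root-bound (suc D) {f = f} c≉0 f-poly xs xs-injective roots with factor-theorem D f-poly (xs Fin.zero)
  ... | h , h-poly , f≈ = root-bound D c≉0 h-poly (xs ∘ Fin.suc)
                            (λ i j eq → Fin.suc-injective (xs-injective _ _ eq)) h-roots
    where
    h-roots : ∀ i → h (xs (Fin.suc i)) ≈ 0#
    h-roots i = x*y≈0⇒y≈0 xᵢ-x₀≉0 (begin
      (xᵢ - x₀) * h xᵢ                 ≈⟨ +-identityʳ _ ⟨
      (xᵢ - x₀) * h xᵢ + 0#            ≈⟨ +-congˡ (roots Fin.zero) ⟨
      (xᵢ - x₀) * h xᵢ + f x₀          ≈⟨ f≈ xᵢ ⟨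
      f xᵢ                             ≈⟨ roots (Fin.suc i) ⟩
      0#                               ∎)
      where
      xᵢ = xs (Fin.suc i)
      x₀ = xs Fin.zero
      xᵢ-x₀≉0 : xᵢ - x₀ ≉ 0#
      xᵢ-x₀≉0 xᵢ-x₀≈0 with xs-injective _ _ (x∙y⁻¹≈ε⇒x≈y xᵢ x₀ xᵢ-x₀≈0)
      ... | ()

  Tr-polynomial : ∀ t r′ → 1 ℕ.< q → 0 ℕ.< t → Polynomial (q ℕ.^ (t ℕ.* r′)) 1# (Tr t (suc r′))
  Tr-polynomial t r′ q>1 t>0 =
    Polynomial-lead D (+-identityˡ 1#) (Polynomial-resp D lower+top≈Tr (Polynomial-+ D lower (Polynomial-pow D)))
    where
    d : ℕ → ℕ
    d j = q ℕ.^ (t ℕ.* j)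

    D = d r′

    lower : Polynomial D 0# (λ x → sum {r′} (λ j → pow x (d (toℕ j))))
    lower = Polynomial-sum D (λ j x → pow x (d (toℕ j)))
              (λ j → Polynomial-pow< D (ℕ.^-monoʳ-< q q>1 (ℕ.*-monoʳ-< t {{ℕ.>-nonZero t>0}} (Fin.toℕ<n j))))

    lower+top≈Tr : ∀ x → sum {r′} (λ j → pow x (d (toℕ j))) + pow x D ≈ Tr t (suc r′) x
    lower+top≈Tr x = trans (sym (sum-last r′ (λ j → pow x (d j)))) (reflexive (≡.sym (Σᶠ≡sum (suc r′) (λ j → pow x (d (toℕ j))))))

  Tr≉0 : ∀ t r′ → 1 ℕ.< q → 0 ℕ.< t → HasSize K (q ℕ.^ (t ℕ.* suc r′)) → ¬ (∀ x → Tr t (suc r′) x ≈ 0#)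
  Tr≉0 t r′ q>1 t>0 (enum , enum-injective , _) Tr≈0 =
    root-bound D 1#≉0# (Tr-polynomial t r′ q>1 t>0) xs xs-injective (Tr≈0 ∘ xs)
    where
    D = q ℕ.^ (t ℕ.* r′)

    D<size : D ℕ.< q ℕ.^ (t ℕ.* suc r′)
    D<size = ℕ.^-monoʳ-< q q>1 (ℕ.*-monoʳ-< t {{ℕ.>-nonZero t>0}} (ℕ.n<1+n r′))

    xs : Fin (suc D) → Carrier
    xs i = enum (Fin.inject≤ i D<size)

    xs-injective : ∀ i j → xs i ≈ xs j → i ≡ j
    xs-injective i j xᵢ≈xⱼ = Fin.inject≤-injective D<size D<size i j (enum-injective _ _ xᵢ≈xⱼ)


  -- Subfields and homogeneous linear systems

  record IsSubfield (S : Carrier → Set) : Set where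
    field
      0#∈            : S 0#
      1#∈            : S 1#
      +-closed       : ∀ {x y} → S x → S y → S (x + y)
      *-closed       : ∀ {x y} → S x → S y → S (x * y)
      -‿closed       : ∀ {x} → S x → S (- x)
      inverse-closed : ∀ {x} (x≉0 : x ≉ 0#) → S x → S (inverse x x≉0)

    sum-closed : ∀ {m} {f : Fin m → Carrier} → (∀ i → S (f i)) → S (sum f)
    sum-closed {zero}  f∈ = 0#∈
    sum-closed {suc m} f∈ = +-closed (f∈ Fin.zero) (sum-closed (f∈ ∘ Fin.suc))

  module _ {S : Carrier → Set} (S-subfield : IsSubfield S) where
    open IsSubfield S-subfield

    NontrivialSolution : ∀ {m n} → (Fin m → Fin n → Carrier) → Set
    NontrivialSolution {m} {n} A = Σ (Fin n → Carrier) λ v →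
      (∀ j → S (v j)) × (∃ λ j → v j ≉ 0#) × (∀ i → sum (λ j → A i j * v j) ≈ 0#)

    first-unit-solution : ∀ {m n} (A : Fin m → Fin (suc n) → Carrier) → (∀ i → A i Fin.zero ≈ 0#) →
                          NontrivialSolution A
    first-unit-solution {n = n} A column₀≈0 = e₀ , e₀∈ , (Fin.zero , 1#≉0#) , e₀-solves
      where
      e₀ : Fin (suc n) → Carrier
      e₀ Fin.zero    = 1#
      e₀ (Fin.suc _) = 0#

      e₀∈ : ∀ j → S (e₀ j)
      e₀∈ Fin.zero    = 1#∈
      e₀∈ (Fin.suc _) = 0#∈

      e₀-solves : ∀ i → sum (λ j → A i j * e₀ j) ≈ 0#
      e₀-solves i = trans (+-cong (trans (*-congʳ (column₀≈0 i)) (zeroˡ 1#)) (sum≈0 (λ j → zeroʳ (A i (Fin.suc j)))))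
                          (+-identityʳ 0#)

    module Elimination {k : ℕ} (A : Fin (suc k) → Fin (suc (suc k)) → Carrier) (A∈ : ∀ i j → S (A i j))
                       (i₀ : Fin (suc k)) (pivot≉0 : A i₀ Fin.zero ≉ 0#) where

      pivot⁻¹ : Carrier
      pivot⁻¹ = inverse (A i₀ Fin.zero) pivot≉0

      eliminated : Fin k → Fin (suc k) → Carrier
      eliminated l j = A (punchIn i₀ l) (Fin.suc j) - (A (punchIn i₀ l) Fin.zero * pivot⁻¹) * A i₀ (Fin.suc j)

      eliminated∈ : ∀ l j → S (eliminated l j)
      eliminated∈ l j = +-closed (A∈ _ _) (-‿closed (*-closed (*-closed (A∈ _ _) (inverse-closed pivot≉0 (A∈ i₀ Fin.zero)))
                                                             (A∈ i₀ (Fin.suc j))))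

      back-substitute : NontrivialSolution eliminated → NontrivialSolution A
      back-substitute (v′ , v′∈ , (j₁ , v′ⱼ₁≉0) , v′-solves) = v , v∈ , (Fin.suc j₁ , v′ⱼ₁≉0) , v-solves
        where
        tail-sum : Fin (suc k) → Carrier
        tail-sum i = sum (λ j → A i (Fin.suc j) * v′ j)

        v : Fin (suc (suc k)) → Carrier
        v Fin.zero    = - (pivot⁻¹ * tail-sum i₀)
        v (Fin.suc j) = v′ j

        v∈ : ∀ j → S (v j)
        v∈ Fin.zero    = -‿closed (*-closed (inverse-closed pivot≉0 (A∈ i₀ Fin.zero))
                                            (sum-closed (λ j → *-closed (A∈ i₀ (Fin.suc j)) (v′∈ j))))
        v∈ (Fin.suc j) = v′∈ j

        reduced : Fin (suc k) → Carrier
        reduced i = tail-sum i - (A i Fin.zero * pivot⁻¹) * tail-sum i₀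

        row : ∀ i → sum (λ j → A i j * v j) ≈ reduced i
        row i = solve 4 (λ a p s₀ s → a :* (:- (p :* s₀)) :+ s := s :- (a :* p) :* s₀) refl
                  (A i Fin.zero) pivot⁻¹ (tail-sum i₀) (tail-sum i)

        reduced-row : ∀ l → reduced (punchIn i₀ l) ≈ sum (λ j → eliminated l j * v′ j)
        reduced-row l = begin
          sum (λ j → a j * v′ j) - c * sum (λ j → b j * v′ j)       ≈⟨ solve 3 (λ s c s′ → s :- c :* s′ := s :+ (:- c) :* s′) refl _ c _ ⟩
          sum (λ j → a j * v′ j) + (- c) * sum (λ j → b j * v′ j)   ≈⟨ +-congˡ (*-distribˡ-sum (- c) (λ j → b j * v′ j)) ⟩
          sum (λ j → a j * v′ j) + sum (λ j → (- c) * (b j * v′ j)) ≈⟨ ∑-distrib-+ (λ j → a j * v′ j) (λ j → (- c) * (b j * v′ j)) ⟨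
          sum (λ j → a j * v′ j + (- c) * (b j * v′ j))             ≈⟨ sum-cong-≋ {suc k} (λ j → solve 4
                                                                          (λ a b c v → a :* v :+ (:- c) :* (b :* v) := (a :- c :* b) :* v)
                                                                          refl (a j) (b j) c (v′ j)) ⟩
          sum (λ j → eliminated l j * v′ j)                         ∎
          where
          a b : Fin (suc k) → Carrier
          a j = A (punchIn i₀ l) (Fin.suc j)
          b j = A i₀ (Fin.suc j)
          c = A (punchIn i₀ l) Fin.zero * pivot⁻¹

        v-solves : ∀ i → sum (λ j → A i j * v j) ≈ 0#
        v-solves i with i Fin.≟ i₀
        ... | yes ≡.refl = begin
          sum (λ j → A i₀ j * v j)                ≈⟨ row i₀ ⟩
          reduced i₀                              ≈⟨ +-congˡ (-‿cong (*-congʳ (inverseʳ _ pivot≉0))) ⟩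
          tail-sum i₀ - 1# * tail-sum i₀          ≈⟨ +-congˡ (-‿cong (*-identityˡ _)) ⟩
          tail-sum i₀ - tail-sum i₀               ≈⟨ -‿inverseʳ _ ⟩
          0#                                      ∎
        ... | no i≢i₀ = begin
          sum (λ j → A i j * v j)                 ≈⟨ row i ⟩
          reduced i                               ≡⟨ ≡.cong reduced (Fin.punchIn-punchOut i₀≢i) ⟨
          reduced (punchIn i₀ l)                  ≈⟨ reduced-row l ⟩
          sum (λ j → eliminated l j * v′ j)       ≈⟨ v′-solves l ⟩
          0#                                      ∎
          where
          i₀≢i = i≢i₀ ∘ ≡.sym
          l = Fin.punchOut i₀≢i

    homogeneous-system : ∀ k (A : Fin k → Fin (suc k) → Carrier) → (∀ i j → S (A i j)) →
                         NontrivialSolution A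
    homogeneous-system zero    A A∈ = (λ _ → 1#) , (λ _ → 1#∈) , (Fin.zero , 1#≉0#) , λ ()
    homogeneous-system (suc k) A A∈ with Fin.any? (λ i → ¬? (A i Fin.zero ≟ 0#))
    ... | yes (i₀ , pivot≉0) = back-substitute (homogeneous-system k eliminated eliminated∈)
      where open Elimination A A∈ i₀ pivot≉0
    ... | no no-pivot        = first-unit-solution A column₀≈0
      where
      column₀≈0 : ∀ i → A i Fin.zero ≈ 0#
      column₀≈0 i with A i Fin.zero ≟ 0#
      ... | yes Aᵢ₀≈0 = Aᵢ₀≈0
      ... | no Aᵢ₀≉0  = ⊥-elim (no-pivot (i , Aᵢ₀≉0))

  -- Frobenius maps, q-polynomials and the trace

  module Frobenius (pow-q-additive : IsAdditive (λ x → pow x q)) where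

    -- InSub s x unfolds to frobenius s x ≈ x, and Tr t r to a sum of frobenius (t * j).
    frobenius : ℕ → Carrier → Carrier
    frobenius s x = pow x (q ℕ.^ s)

    frobenius-additive : ∀ s → IsAdditive (frobenius s)
    frobenius-additive = pow-^-additive pow-q-additive

    frobenius-* : ∀ s x y → frobenius s (x * y) ≈ frobenius s x * frobenius s y
    frobenius-* s x y = pow-distrib-* x y (q ℕ.^ s)

    frobenius-∘ : ∀ a b x → frobenius a (frobenius b x) ≈ frobenius (b ℕ.+ a) x
    frobenius-∘ a b x = trans (pow-assoc x (q ℕ.^ b) (q ℕ.^ a))
                          (reflexive (≡.cong (pow x) (≡.sym (ℕ.^-distribˡ-+-* q b a))))

    frobenius-zero : ∀ x → frobenius 0 x ≈ x
    frobenius-zero = *-identityʳ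

    frobenius-pow-q : ∀ s x → pow (frobenius s x) q ≈ frobenius s (pow x q)
    frobenius-pow-q s x = begin
      pow (pow x (q ℕ.^ s)) q  ≈⟨ pow-assoc x (q ℕ.^ s) q ⟩
      pow x (q ℕ.^ s ℕ.* q)    ≡⟨ ≡.cong (pow x) (ℕ.*-comm (q ℕ.^ s) q) ⟩
      pow x (q ℕ.* q ℕ.^ s)    ≈⟨ pow-assoc x q _ ⟨
      pow (pow x q) (q ℕ.^ s)  ∎

    frobenius-- : ∀ s x y → frobenius s (x - y) ≈ frobenius s x - frobenius s y
    frobenius-- s x y = trans (+-homo (frobenius-additive s) x (- y)) (+-congˡ (-‿homo (frobenius-additive s) y))

    InSub-iterate : ∀ t {x} → InSub t x → ∀ j → InSub (t ℕ.* j) x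
    InSub-iterate t {x} x∈ zero    rewrite ℕ.*-zeroʳ t = frobenius-zero x
    InSub-iterate t {x} x∈ (suc j) = begin
      frobenius (t ℕ.* suc j) x          ≡⟨ ≡.cong (λ s → frobenius s x) (≡.trans (ℕ.*-suc t j) (ℕ.+-comm t (t ℕ.* j))) ⟩
      frobenius (t ℕ.* j ℕ.+ t) x        ≈⟨ frobenius-∘ t (t ℕ.* j) x ⟨
      frobenius t (frobenius (t ℕ.* j) x) ≈⟨ cong (frobenius-additive t) (InSub-iterate t x∈ j) ⟩
      frobenius t x                      ≈⟨ x∈ ⟩
      x                                  ∎

    InSub-isSubfield : ∀ s → IsSubfield (InSub s)
    InSub-isSubfield s = record
      { 0#∈            = 0-homo (frobenius-additive s)
      ; 1#∈            = pow-1# (q ℕ.^ s)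
      ; +-closed       = λ x∈ y∈ → trans (+-homo (frobenius-additive s) _ _) (+-cong x∈ y∈)
      ; *-closed       = λ x∈ y∈ → trans (frobenius-* s _ _) (*-cong x∈ y∈)
      ; -‿closed       = λ x∈ → trans (-‿homo (frobenius-additive s) _) (-‿cong x∈)
      ; inverse-closed = inverse∈
      }
      where
      inverse∈ : ∀ {x} (x≉0 : x ≉ 0#) → InSub s x → InSub s (inverse x x≉0)
      inverse∈ {x} x≉0 x∈ = begin
        F x⁻¹                     ≈⟨ *-identityʳ _ ⟨
        F x⁻¹ * 1#                ≈⟨ *-congˡ (inverseʳ x x≉0) ⟨
        F x⁻¹ * (x * x⁻¹)         ≈⟨ *-congˡ (*-congʳ x∈) ⟨
        F x⁻¹ * (F x * x⁻¹)       ≈⟨ *-assoc _ _ _ ⟨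
        F x⁻¹ * F x * x⁻¹         ≈⟨ *-congʳ (frobenius-* s x⁻¹ x) ⟨
        F (x⁻¹ * x) * x⁻¹         ≈⟨ *-congʳ (trans (cong (frobenius-additive s) (inverseˡ x x≉0)) (pow-1# (q ℕ.^ s))) ⟩
        1# * x⁻¹                  ≈⟨ *-identityˡ x⁻¹ ⟩
        x⁻¹                       ∎
        where
        x⁻¹ = inverse x x≉0
        F = frobenius s

    scale-frobenius : ∀ s {c} → InSub s c → ∀ x → c * frobenius s x ≈ frobenius s (c * x)
    scale-frobenius s {c} c∈ x = sym (trans (frobenius-* s c x) (*-congʳ c∈))

    evalQ-additive : ∀ cs → IsAdditive (evalQ cs)
    evalQ-additive []       = record { cong = λ _ → refl ; +-homo = λ _ _ → sym (+-identityˡ 0#) }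
    evalQ-additive (c ∷ cs) = IsAdditive-+ (IsAdditive-scale c) (IsAdditive-∘ (evalQ-additive cs) pow-q-additive)

    evalQ-frobenius : ∀ s {cs} → All (InSub s) cs → ∀ x → evalQ cs (frobenius s x) ≈ frobenius s (evalQ cs x)
    evalQ-frobenius s []              x = sym (0-homo (frobenius-additive s))
    evalQ-frobenius s {c ∷ cs} (c∈ ∷ cs∈) x = begin
      c * frobenius s x + evalQ cs (pow (frobenius s x) q)   ≈⟨ +-cong (scale-frobenius s c∈ x)
                                                                  (cong (evalQ-additive cs) (frobenius-pow-q s x)) ⟩
      frobenius s (c * x) + evalQ cs (frobenius s (pow x q)) ≈⟨ +-congˡ (evalQ-frobenius s cs∈ (pow x q)) ⟩
      frobenius s (c * x) + frobenius s (evalQ cs (pow x q)) ≈⟨ +-homo (frobenius-additive s) _ _ ⟨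
      frobenius s (c * x + evalQ cs (pow x q))               ∎

    evalQ-affine-frobenius : ∀ s {cs a} → All (InSub s) cs → InSub s a → ∀ x →
                             evalQ cs (frobenius s x) - a * frobenius s x ≈ frobenius s (evalQ cs x - a * x)
    evalQ-affine-frobenius s cs∈ a∈ x = trans (+-cong (evalQ-frobenius s cs∈ x) (-‿cong (scale-frobenius s a∈ x)))
                                              (sym (frobenius-- s _ _))

    module Trace (t r : ℕ) where

      Tr≡sum : ∀ x → Tr t r x ≡ sum {r} (λ j → frobenius (t ℕ.* toℕ j) x)
      Tr≡sum x = Σᶠ≡sum r _

      Tr-additive : IsAdditive (Tr t r)
      Tr-additive = IsAdditive-resp (λ x → reflexive (≡.sym (Tr≡sum x)))
                      (IsAdditive-sum {r} (λ j → frobenius-additive (t ℕ.* toℕ j)))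

      Tr-commute : ∀ {h} → IsAdditive h → (∀ j x → h (frobenius (t ℕ.* j) x) ≈ frobenius (t ℕ.* j) (h x)) →
                   ∀ x → Tr t r (h x) ≈ h (Tr t r x)
      Tr-commute {h} h-additive h-commutes x = begin
        Tr t r (h x)                                      ≡⟨ Tr≡sum (h x) ⟩
        sum {r} (λ j → frobenius (t ℕ.* toℕ j) (h x))     ≈⟨ sum-cong-≋ {r} (λ j → sym (h-commutes (toℕ j) x)) ⟩
        sum {r} (λ j → h (frobenius (t ℕ.* toℕ j) x))     ≈⟨ sum-homo h-additive {r} (λ j → frobenius (t ℕ.* toℕ j) x) ⟨
        h (sum {r} (λ j → frobenius (t ℕ.* toℕ j) x))     ≡⟨ ≡.cong h (Tr≡sum x) ⟨
        h (Tr t r x)                                      ∎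

      Tr-linear : ∀ {c} → InSub t c → ∀ x → Tr t r (c * x) ≈ c * Tr t r x
      Tr-linear c∈ = Tr-commute (IsAdditive-scale _) (λ j → scale-frobenius (t ℕ.* j) (InSub-iterate t c∈ j))

      -- frobenius t shifts the terms of the trace by one; x^{q^{tr}} = x closes the cycle.
      Tr∈ : (∀ x → frobenius (t ℕ.* r) x ≈ x) → ∀ x → InSub t (Tr t r x)
      Tr∈ fermat x = begin
        frobenius t (Tr t r x)                  ≡⟨ ≡.cong (frobenius t) (Tr≡sum x) ⟩
        frobenius t (sum {r} (λ j → h (toℕ j))) ≈⟨ sum-homo (frobenius-additive t) {r} (λ j → h (toℕ j)) ⟩
        sum {r} (λ j → frobenius t (h (toℕ j))) ≈⟨ sum-cong-≋ {r} (λ j → h-shift (toℕ j)) ⟩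
        sum {r} (λ j → h (suc (toℕ j)))         ≈⟨ x+y≈z+x⇒y≈z shifted ⟩
        sum {r} (λ j → h (toℕ j))               ≡⟨ Tr≡sum x ⟨
        Tr t r x                                ∎
        where
        h : ℕ → Carrier
        h j = frobenius (t ℕ.* j) x

        h-zero : h 0 ≈ x
        h-zero = trans (reflexive (≡.cong (λ s → frobenius s x) (ℕ.*-zeroʳ t))) (frobenius-zero x)

        h-shift : ∀ j → frobenius t (h j) ≈ h (suc j)
        h-shift j = trans (frobenius-∘ t (t ℕ.* j) x)
                      (reflexive (≡.cong (λ s → frobenius s x) (≡.trans (ℕ.+-comm (t ℕ.* j) t) (≡.sym (ℕ.*-suc t j)))))

        shifted : h 0 + sum {r} (λ j → h (suc (toℕ j))) ≈ sum {r} (λ j → h (toℕ j)) + h 0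
        shifted = begin
          sum {suc r} (λ j → h (toℕ j))                                 ≈⟨ sum-last r h ⟩
          sum {r} (λ j → h (toℕ j)) + h r                               ≈⟨ +-congˡ (trans (fermat x) (sym h-zero)) ⟩
          sum {r} (λ j → h (toℕ j)) + h 0                               ∎

    -- The projectivity

    module _ (t r′ : ℕ) (fermat : ∀ x → frobenius (t ℕ.* suc r′) x ≈ x)
             (Tr≢0 : ¬ (∀ x → Tr t (suc r′) x ≈ 0#)) where

      r : ℕ
      r = suc r′

      open Trace t r
      open IsSubfield (InSub-isSubfield t)

      Tr-sum-linear : ∀ {m} (cs es : Fin m → Carrier) → (∀ j → InSub t (cs j)) → ∀ w →
                      Tr t r (sum (λ j → cs j * es j) * w) ≈ sum (λ j → cs j * Tr t r (es j * w))
      Tr-sum-linear {m} cs es cs∈ w = begin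
        Tr t r (sum (λ j → cs j * es j) * w)      ≈⟨ cong Tr-additive (*-distribʳ-sum w (λ j → cs j * es j)) ⟩
        Tr t r (sum (λ j → cs j * es j * w))      ≈⟨ sum-homo Tr-additive (λ j → cs j * es j * w) ⟩
        sum (λ j → Tr t r (cs j * es j * w))      ≈⟨ sum-cong-≋ {m} (λ j → trans (cong Tr-additive (*-assoc _ _ _))
                                                                               (Tr-linear (cs∈ j) _)) ⟩
        sum (λ j → cs j * Tr t r (es j * w))      ∎

      module _ (ω : Carrier) (basis : IsBasis t r ω) where

        ωpow : Fin r → Carrier
        ωpow j = pow ω (toℕ j)

        trace-form : Fin r′ → Fin r → Carrier
        trace-form i j = Tr t r (ωpow j * pow ω (suc (toℕ i)))

        OrthogonalToHigherPowers : Carrier → Set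
        OrthogonalToHigherPowers β = ∀ (i : Fin r′) → Tr t r (β * pow ω (suc (toℕ i))) ≈ 0#

        annihilator : Σ Carrier λ β₀ → β₀ ≉ 0# × OrthogonalToHigherPowers β₀
        annihilator with homogeneous-system (InSub-isSubfield t) r′ trace-form (λ i j → Tr∈ fermat _)
        ... | c , c∈ , (j₀ , cⱼ₀≉0) , c-solves = β₀ , β₀≉0 , Trβ₀ω≈0
          where
          β₀ = sum (λ j → c j * ωpow j)

          β₀≉0 : β₀ ≉ 0#
          β₀≉0 β₀≈0 = cⱼ₀≉0 (proj₁ basis c c∈ (trans (reflexive (Σᶠ≡sum r (λ j → c j * ωpow j))) β₀≈0) j₀)

          Trβ₀ω≈0 : OrthogonalToHigherPowers β₀
          Trβ₀ω≈0 i = trans (Tr-sum-linear c ωpow c∈ (pow ω (suc (toℕ i))))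
                        (trans (sum-cong-≋ {r} (λ j → *-comm (c j) (trace-form i j))) (c-solves i))

        module _ {β₀ : Carrier} (β₀≉0 : β₀ ≉ 0#) (Trβ₀ω≈0 : OrthogonalToHigherPowers β₀)
                 {b : Carrier} (b∈ : InSub t b) (b≉0 : b ≉ 0#) where

          -- Otherwise Tr (β₀ _) would vanish on 1 = b · b⁻¹ and on ω, …, ω^{r-1}, hence on all of K.
          Trβ₀b≉0 : Tr t r (β₀ * b) ≉ 0#
          Trβ₀b≉0 Trβ₀b≈0 = Tr≢0 Tr≈0
            where
            Tr-ωβ₀≈0 : ∀ j → Tr t r (ωpow j * β₀) ≈ 0#
            Tr-ωβ₀≈0 Fin.zero = begin
              Tr t r (1# * β₀)                        ≈⟨ cong Tr-additive (trans (*-identityˡ β₀) (sym (inverse-cancelˡ b b≉0 β₀))) ⟩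
              Tr t r (inverse b b≉0 * (b * β₀))       ≈⟨ cong Tr-additive (*-congˡ (*-comm b β₀)) ⟩
              Tr t r (inverse b b≉0 * (β₀ * b))       ≈⟨ Tr-linear (inverse-closed b≉0 b∈) (β₀ * b) ⟩
              inverse b b≉0 * Tr t r (β₀ * b)         ≈⟨ *-congˡ Trβ₀b≈0 ⟩
              inverse b b≉0 * 0#                      ≈⟨ zeroʳ _ ⟩
              0#                                      ∎
            Tr-ωβ₀≈0 (Fin.suc i) = trans (cong Tr-additive (*-comm (pow ω (suc (toℕ i))) β₀)) (Trβ₀ω≈0 i)

            Tr≈0 : ∀ x → Tr t r x ≈ 0#
            Tr≈0 x = begin
              Tr t r x                                   ≈⟨ cong Tr-additive (inverse-cancelʳ β₀ β₀≉0 x) ⟨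
              Tr t r (β₀ * y)                            ≈⟨ cong Tr-additive (*-comm β₀ y) ⟩
              Tr t r (y * β₀)                            ≈⟨ cong Tr-additive (*-congʳ (trans y≈ (reflexive (Σᶠ≡sum r (λ j → ys j * ωpow j))))) ⟩
              Tr t r (sum (λ j → ys j * ωpow j) * β₀)    ≈⟨ Tr-sum-linear ys ωpow ys∈ β₀ ⟩
              sum (λ j → ys j * Tr t r (ωpow j * β₀))    ≈⟨ sum≈0 (λ j → trans (*-congˡ (Tr-ωβ₀≈0 j)) (zeroʳ (ys j))) ⟩
              0#                                         ∎
              where
              y = inverse β₀ β₀≉0 * x
              ys = proj₁ (proj₂ basis y)
              ys∈ = proj₁ (proj₂ (proj₂ basis y))
              y≈ = proj₂ (proj₂ (proj₂ basis y))

          β : Carrier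
          β = inverse (Tr t r (β₀ * b)) Trβ₀b≉0 * β₀

          β-scale∈ : InSub t (inverse (Tr t r (β₀ * b)) Trβ₀b≉0)
          β-scale∈ = inverse-closed Trβ₀b≉0 (Tr∈ fermat (β₀ * b))

          Trβb≈1 : Tr t r (β * b) ≈ 1#
          Trβb≈1 = trans (cong Tr-additive (*-assoc _ β₀ b))
                     (trans (Tr-linear β-scale∈ (β₀ * b)) (inverseˡ (Tr t r (β₀ * b)) Trβ₀b≉0))

          Trβω≈0 : OrthogonalToHigherPowers β
          Trβω≈0 i = trans (cong Tr-additive (*-assoc _ β₀ (pow ω (suc (toℕ i)))))
                       (trans (Tr-linear β-scale∈ (β₀ * pow ω (suc (toℕ i))))
                              (trans (*-congˡ (Trβ₀ω≈0 i)) (zeroʳ _)))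

          β≉0 : β ≉ 0#
          β≉0 = x*y≉0 (inverse≉0 _ Trβ₀b≉0) β₀≉0

          dual-coordinate : ∀ {x₀} (xs : Fin r′ → Carrier) → InSub t x₀ → (∀ i → InSub t (xs i)) →
                            Tr t r (β * (b * x₀ + Σᶠ r′ (λ i → xs i * pow ω (suc (toℕ i))))) ≈ x₀
          dual-coordinate {x₀} xs x₀∈ xs∈ = begin
            Tr t r (β * (b * x₀ + Σ′))                   ≈⟨ trans (cong Tr-additive (distribˡ β _ Σ′)) (+-homo Tr-additive _ _) ⟩
            Tr t r (β * (b * x₀)) + Tr t r (β * Σ′)      ≈⟨ +-cong coordinate-x₀ coordinates-xs ⟩
            x₀ * 1# + 0#                                 ≈⟨ trans (+-identityʳ _) (*-identityʳ x₀) ⟩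
            x₀                                           ∎
            where
            Σ′ = Σᶠ r′ (λ i → xs i * pow ω (suc (toℕ i)))

            coordinate-x₀ : Tr t r (β * (b * x₀)) ≈ x₀ * 1#
            coordinate-x₀ = begin
              Tr t r (β * (b * x₀))   ≈⟨ cong Tr-additive (solve 3 (λ β b x → β :* (b :* x) := x :* (β :* b)) refl β b x₀) ⟩
              Tr t r (x₀ * (β * b))   ≈⟨ Tr-linear x₀∈ (β * b) ⟩
              x₀ * Tr t r (β * b)     ≈⟨ *-congˡ Trβb≈1 ⟩
              x₀ * 1#                 ∎

            coordinates-xs : Tr t r (β * Σ′) ≈ 0#
            coordinates-xs = begin
              Tr t r (β * Σ′)                                                 ≈⟨ cong Tr-additive (trans (*-comm β Σ′)
                                                                                   (*-congʳ (reflexive (Σᶠ≡sum r′ (λ i → xs i * pow ω (suc (toℕ i))))))) ⟩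
              Tr t r (sum (λ i → xs i * pow ω (suc (toℕ i))) * β)             ≈⟨ Tr-sum-linear xs (λ i → pow ω (suc (toℕ i))) xs∈ β ⟩
              sum (λ i → xs i * Tr t r (pow ω (suc (toℕ i)) * β))             ≈⟨ sum≈0 (λ i → trans (*-congˡ (trans
                                                                                   (cong Tr-additive (*-comm (pow ω (suc (toℕ i))) β)) (Trβω≈0 i)))
                                                                                   (zeroʳ (xs i))) ⟩
              0#                                                              ∎

          module _ {f : List Carrier} {a : Carrier} (f∈ : InLtq t f) (a∈ : InSub t a) where

            g : Carrier → Carrier
            g x = evalQ f x - a * x

            g-additive : IsAdditive g
            g-additive = IsAdditive-- (evalQ-additive f) (IsAdditive-scale a)

            Tr-g : ∀ x → Tr t r (g x) ≈ g (Tr t r x)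
            Tr-g = Tr-commute g-additive
                     (λ j → evalQ-affine-frobenius (t ℕ.* j) (All.map (λ c∈ → InSub-iterate t c∈ j) f∈) (InSub-iterate t a∈ j))

            det≉0 : 0# * 0# - β * 1# ≉ 0#
            det≉0 det≈0 = β≉0 (begin
              β                        ≈⟨ -‿involutive β ⟨
              - (- β)                  ≈⟨ -‿cong (trans (+-cong (zeroˡ 0#) (-‿cong (*-identityʳ β))) (+-identityˡ (- β))) ⟨
              - (0# * 0# - β * 1#)     ≈⟨ -‿cong det≈0 ⟩
              - 0#                     ≈⟨ -0#≈0# ⟩
              0#                       ∎)

            forward : (P : Vec2) → Nonzero P → InLinSet (Uab t r f a b ω) P → InLinSet (Up t r f a) (act 0# β 1# 0# P)
            forward (Pu , Pv) _ ((u , v) , (x₀ , xs , x₀∈ , xs∈ , u≈ , v≈) , w≢0 , (l , l≉0 , Pu≈ , Pv≈)) =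
              (β * v , u) , u∈Up , w′≢0 , (l , l≉0 , first , second)
              where
              u∈Up : u ≈ Tr t r (g (β * v))
              u∈Up = sym (begin
                Tr t r (g (β * v))   ≈⟨ Tr-g (β * v) ⟩
                g (Tr t r (β * v))   ≈⟨ cong g-additive (trans (cong Tr-additive (*-congˡ v≈)) (dual-coordinate xs x₀∈ xs∈)) ⟩
                g x₀                 ≈⟨ u≈ ⟨
                u                    ∎)

              w′≢0 : Nonzero (β * v , u)
              w′≢0 (βv≈0 , u≈0) = w≢0 (u≈0 , x*y≈0⇒y≈0 β≉0 βv≈0)

              first : 0# * Pu + β * Pv ≈ l * (β * v)
              first = begin
                0# * Pu + β * Pv     ≈⟨ +-cong (zeroˡ Pu) (*-congˡ Pv≈) ⟩
                0# + β * (l * v)     ≈⟨ +-identityˡ _ ⟩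
                β * (l * v)          ≈⟨ solve 3 (λ β l v → β :* (l :* v) := l :* (β :* v)) refl β l v ⟩
                l * (β * v)          ∎

              second : 1# * Pu + 0# * Pv ≈ l * u
              second = trans (+-cong (*-identityˡ Pu) (zeroˡ Pv)) (trans (+-identityʳ Pu) Pu≈)

            backward : (Q : Vec2) → Nonzero Q → InLinSet (Up t r f a) Q →
                       Σ Vec2 λ P → Nonzero P × InLinSet (Uab t r f a b ω) P × SamePoint (act 0# β 1# 0# P) Q
            backward (Qu , Qv) _ ((x , y) , y≈ , w≢0 , (l , l≉0 , Qu≈ , Qv≈)) =
              (g x₀ , z) , P≢0 , ((g x₀ , z) , (x₀ , xs , x₀∈ , xs∈ , refl , z≈) , P≢0 , (1# , 1#≉0# , same , same)) ,
              (l , l≉0 , first , second)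
              where
              z = inverse β β≉0 * x
              ys = proj₁ (proj₂ basis z)
              ys∈ = proj₁ (proj₂ (proj₂ basis z))
              z≈Σ = proj₂ (proj₂ (proj₂ basis z))

              x₀ = ys Fin.zero * inverse b b≉0
              x₀∈ : InSub t x₀
              x₀∈ = *-closed (ys∈ Fin.zero) (inverse-closed b≉0 b∈)

              xs : Fin r′ → Carrier
              xs = ys ∘ Fin.suc
              xs∈ : ∀ i → InSub t (xs i)
              xs∈ = ys∈ ∘ Fin.suc

              z≈ : z ≈ b * x₀ + Σᶠ r′ (λ i → xs i * pow ω (suc (toℕ i)))
              z≈ = trans z≈Σ (+-congʳ (begin
                ys Fin.zero * 1#                         ≈⟨ *-congˡ (inverseʳ b b≉0) ⟨
                ys Fin.zero * (b * inverse b b≉0)        ≈⟨ solve 3 (λ y b b′ → y :* (b :* b′) := b :* (y :* b′)) refl _ b _ ⟩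
                b * x₀                                   ∎))

              x≈βz : x ≈ β * z
              x≈βz = sym (inverse-cancelʳ β β≉0 x)

              y≈gx₀ : y ≈ g x₀
              y≈gx₀ = trans y≈ (trans (Tr-g x) (cong g-additive (trans (cong Tr-additive (trans x≈βz (*-congˡ z≈)))
                                                               (dual-coordinate xs x₀∈ xs∈))))

              P≢0 : Nonzero (g x₀ , z)
              P≢0 (gx₀≈0 , z≈0) = w≢0 (trans x≈βz (trans (*-congˡ z≈0) (zeroʳ β)) , trans y≈gx₀ gx₀≈0)

              same : ∀ {u} → u ≈ 1# * u
              same = sym (*-identityˡ _)

              first : Qu ≈ l * (0# * g x₀ + β * z)
              first = trans Qu≈ (*-congˡ (trans x≈βz (sym (trans (+-congʳ (zeroˡ _)) (+-identityˡ _)))))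

              second : Qv ≈ l * (1# * g x₀ + 0# * z)
              second = trans Qv≈ (*-congˡ (trans y≈gx₀ (sym (trans (+-cong (*-identityˡ _) (zeroˡ z)) (+-identityʳ _)))))

            Uab≃Up : PGLEquiv (Uab t r f a b ω) (Up t r f a)
            Uab≃Up = 0# , β , 1# , 0# , det≉0 , forward , backward

        PGLEquiv-Uab-Up : ∀ {b f a} → InSub t b → b ≉ 0# → InLtq t f → InSub t a →
                          PGLEquiv (Uab t r f a b ω) (Up t r f a)
        PGLEquiv-Uab-Up b∈ b≉0 f∈ a∈ = Uab≃Up (proj₁ (proj₂ annihilator)) (proj₂ (proj₂ annihilator)) b∈ b≉0 f∈ a∈

open import Data.Nat using (_*_; _^_; _>_)

theorem5p3 : (q t r n : ℕ) → IsPrimePower q → t > 1 → r > 1 → n ≡ t * r →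
    (K : Field) → HasSize K (q ^ n) →
    let open FieldDefs K q in
    (f : List Carrier) → InLtq t f → Scattered t f →
    (a b : Carrier) → InSub t a → InSub t b → ¬ (b ≈ 0#) →
    (ω : Carrier) → IsBasis t r ω →
    PGLEquiv (Uab t r f a b ω) (Up t r f a)
theorem5p3 q t zero n _ _ () _ K _ _ _ _ _ _ _ _ _ _ _
theorem5p3 q t (suc r′) n (p , k , p-prime , k>0 , q≡pᵏ) t>1 _ n≡tr K size f f∈ _ a b a∈ b∈ b≉0 ω basis =
  PGLEquiv-Uab-Up t r′ fermat-tr Tr≢0 ω basis b∈ b≉0 f∈ a∈
  where
  open FieldDefs K q using (_≈_; 0#; pow; Tr)
  open FieldTheory K q
  open OfPrimePowerOrder {p} {k} {n} p-prime q≡pᵏ size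
  open Frobenius pow-q-additive

  q>1 : 1 ℕ.< q
  q>1 = ≡.subst (1 ℕ.<_) (≡.sym q≡pᵏ) (ℕ.^-monoʳ-< p (ℕ.nonTrivial⇒n>1 p {{prime⇒nonTrivial p-prime}}) k>0)

  fermat-tr : ∀ x → frobenius (t * suc r′) x ≈ x
  fermat-tr x = ≡.subst (λ m → pow x (q ^ m) ≈ x) n≡tr (fermat-qⁿ x)

  Tr≢0 : ¬ (∀ x → Tr t (suc r′) x ≈ 0#)
  Tr≢0 = Tr≉0 t r′ q>1 (ℕ.<-trans ℕ.z<s t>1) (≡.subst (λ m → HasSize K (q ^ m)) n≡tr size)
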